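{- Let $\mathcal{P}$ be a profile of unrooted phylogenetic trees whose display graph $G(\mathcal{P})$ is connected, let $T\in\mathcal{P}$, and let $F$ be a minimal cut of $G(\mathcal{P})$ with $F\cap E(T)=\{e\}$. Let $T_1,T_2$ be the two subtrees of $T-e$. Then for any edge $f_1$ of $T_1$ and any edge $f_2$ of $T_2$, $f_1$ and $f_2$ lie in different connected components of $G(\mathcal{P})-F$.
   Context: A phylogenetic tree is an unrooted tree whose leaves are bijectively labelled by a finite label set; leaves are identified with labels. A profile is a finite collection $\mathcal{P}=\{T_1,\dots,T_k\}$ of phylogenetic trees with pairwise disjoint sets of internal vertices. The display graph $G(\mathcal{P})$ has vertex set $\bigcup_iV(T_i)$ and edge set $\bigcup_iE(T_i)$. A cut of a connected graph $G$ is $F\subseteq E(G)$ with $G-F$ (vertex set $V(G)$, edges $E(G)\setminus F$) disconnected; it is minimal if no proper subset of $F$ is a cut. -}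

module Defs where

open import Data.Nat using (ℕ; _≤_)
open import Data.Fin using (Fin)
open import Data.List using (List; []; _∷_; length; _∷ʳ_)
open import Data.List.Membership.Propositional using (_∈_)
open import Data.List.Relation.Unary.Linked using (Linked)
open import Data.List.Relation.Unary.Unique.Propositional using (Unique)
open import Relation.Binary.Construct.Closure.ReflexiveTransitive using (Star)
open import Data.Product using (Σ; ∃; _×_; _,_)
open import Data.Sum using (_⊎_)
open import Relation.Nullary using (¬_)
open import Relation.Binary.PropositionalEquality using (_≡_; _≢_)

-- A (simple, undirected) graph is given
-- by a vertex predicate and a symmetric adjacency relation; a set of edges is a
-- symmetric relation (the unordered edge {u,v} is in F iff F u v).

module _ {V : Set} where

  SameEdge : V → V → V → V → Set
  SameEdge u v a b = (u ≡ a × v ≡ b) ⊎ (u ≡ b × v ≡ a)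

  Connected : (V → Set) → (V → V → Set) → Set
  Connected vert adj = ∀ u v → vert u → vert v → Star adj u v

  Acyclic : (V → V → Set) → Set
  Acyclic adj = ∀ x xs →
    ¬ (3 ≤ length (x ∷ xs) × Unique (x ∷ xs) × Linked adj ((x ∷ xs) ∷ʳ x))

  -- a leaf: a vertex with at most one neighbour (degree 1, or the single
  -- vertex of a one-vertex tree)
  IsLeaf : (V → V → Set) → V → Set
  IsLeaf adj v = ∀ w w' → adj v w → adj v w' → w ≡ w'

  -- Lab : the (global) label set; leaves are identified with labels.
  record PhyloTree (Lab : V → Set) : Set₁ where
    field
      vert       : V → Set
      adj        : V → V → Set
      adj-sym    : ∀ {u v} → adj u v → adj v u
      adj-irrefl : ∀ {u} → ¬ adj u u
      adj-vert   : ∀ {u v} → adj u v → vert u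
      finite     : Σ (List V) λ vs → ∀ v → vert v → v ∈ vs
      nonempty   : Σ V vert
      connected  : Connected vert adj
      acyclic    : Acyclic adj
      leaf→label : ∀ v → vert v → IsLeaf adj v → Lab v
      label→leaf : ∀ v → vert v → Lab v → IsLeaf adj v

  open PhyloTree public

  module _ {Lab : V → Set} {k : ℕ} (P : Fin k → PhyloTree Lab) where

    -- pairwise disjoint internal vertices: a vertex shared by two distinct
    -- trees is a label (i.e. a leaf of both)
    IsProfile : Set
    IsProfile = ∀ i j v → i ≢ j → vert (P i) v → vert (P j) v → Lab v

    DVert : V → Set
    DVert v = ∃ λ i → vert (P i) v

    DAdj : V → V → Set
    DAdj u v = ∃ λ i → adj (P i) u v

  Minus : (V → V → Set) → (V → V → Set) → V → V → Set
  Minus adj F u v = adj u v × ¬ F u v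

  IsCut : (V → Set) → (V → V → Set) → (V → V → Set) → Set
  IsCut vert adj F =
    (∀ u v → F u v → F v u) × (∀ u v → F u v → adj u v) ×
    ¬ Connected vert (Minus adj F)

  IsMinimalCut : (V → Set) → (V → V → Set) → (V → V → Set) → Set₁
  IsMinimalCut vert adj F =
    IsCut vert adj F ×
    (∀ (F' : V → V → Set) → (∀ u v → F' u v → F' v u) →
       (∀ u v → F' u v → F u v) → (∃ λ u → ∃ λ v → F u v × ¬ F' u v) →
       ¬ IsCut vert adj F')

module Submission where

-- If x₁ and x₂ were joined in G − F, then together with the paths of T − e
-- from a to x₁ and from x₂ to b they would join the endpoints a, b of e in
-- G − F.  Then every edge of G − (F ∖ {e}) still joins vertices connected in
-- G − F, so F ∖ {e} would be a smaller cut, contradicting minimality.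
-- Deciding whether an edge lies in F is classical; since the goal is a
-- negation this is done inside the double-negation monad, and the finiteness
-- of the vertex set lets it commute with the quantification over vertices.

open import Defs
open import Data.Nat using (ℕ)
open import Data.Fin using (Fin)
open import Data.Product using (_×_; _,_; proj₁; proj₂)
open import Data.Sum using (inj₁; inj₂; [_,_])
open import Data.Empty using (⊥-elim)
open import Data.List using (List; concatMap; allFin)
open import Data.List.Relation.Unary.All as All using (All)
open import Data.List.Membership.Propositional using (_∈_; lose)
open import Data.List.Membership.Propositional.Properties using (∈-concatMap⁺; ∈-allFin)
open import Function using (const; _∘_)
open import Level using (0ℓ)
open import Relation.Nullary using (¬_)
open import Relation.Nullary.Negation using (¬¬-Monad; ¬¬-map)
open import Relation.Binary.PropositionalEquality using (refl)
open import Relation.Binary.Construct.Closure.ReflexiveTransitive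
  using (Star; ε; _◅_; _◅◅_; _⋆; map; reverse)

¬¬-All : {A : Set} {P : A → Set} (xs : List A) → (∀ x → ¬ ¬ P x) → ¬ ¬ All P xs
¬¬-All xs ¬¬P = All.sequenceM 0ℓ ¬¬-Monad (All.tabulate λ {x} _ → ¬¬P x)

¬¬-→ : {A B : Set} → (A → ¬ ¬ B) → ¬ ¬ (A → B)
¬¬-→ f ¬[A→B] = ¬[A→B] λ a → ⊥-elim (f a λ b → ¬[A→B] (const b))

module _ {V : Set} where

  SameEdge-sym : ∀ {u v a b : V} → SameEdge u v a b → SameEdge v u a b
  SameEdge-sym (inj₁ (u≡a , v≡b)) = inj₂ (v≡b , u≡a)
  SameEdge-sym (inj₂ (u≡b , v≡a)) = inj₁ (v≡a , u≡b)

  Minus-sym : {adj F : V → V → Set} → (∀ {u v} → adj u v → adj v u) →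
    (∀ u v → F u v → F v u) → ∀ {u v} → Minus adj F u v → Minus adj F v u
  Minus-sym adj-sym F-sym (e , ¬f) = adj-sym e , ¬f ∘ F-sym _ _

  Without : (V → V → Set) → V → V → V → V → Set
  Without F a b u v = F u v × ¬ SameEdge u v a b

  module _ {vert : V → Set} (vs : List V) (vs-complete : ∀ {v} → vert v → v ∈ vs) where

    ¬Connected-transfer : {R S : V → V → Set} →
      (∀ {u v} → R u v → vert u × vert v) →
      (∀ {u v} → R u v → ¬ ¬ Star S u v) →
      ¬ Connected vert S → ¬ Connected vert R
    ¬Connected-transfer {R} {S} R-ends R⇒S ¬connS connR =
      ¬¬-All vs (λ u → ¬¬-All vs (λ v → ¬¬-→ (R⇒S {u} {v}))) λ steps →
      ¬connS λ u v u-vert v-vert → (step steps ⋆) (connR u v u-vert v-vert)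
      where
      step : All (λ u → All (λ v → R u v → Star S u v) vs) vs →
        ∀ {u v} → R u v → Star S u v
      step steps r = All.lookup (All.lookup steps (vs-complete (proj₁ (R-ends r))))
                                (vs-complete (proj₂ (R-ends r))) r

    module _ {adj : V → V → Set}
      (adj-ends : ∀ {u v} → adj u v → vert u × vert v)
      (adj-sym : ∀ {u v} → adj u v → adj v u) where

      minimalCut-separates : {F : V → V → Set} → IsMinimalCut vert adj F →
        ∀ {a b} → F a b → ¬ Star (Minus adj F) a b
      minimalCut-separates {F} ((F-sym , F⊆adj , ¬connected) , minimal) {a} {b} Fab a⇝b =
        minimal (Without F a b) Without-sym (λ _ _ → proj₁)
          (a , b , Fab , λ (_ , ¬ab) → ¬ab (inj₁ (refl , refl)))
          (Without-sym , (λ u v → F⊆adj u v ∘ proj₁) ,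
           ¬Connected-transfer (adj-ends ∘ proj₁) edge-joined ¬connected)
        where
        Without-sym : ∀ u v → Without F a b u v → Without F a b v u
        Without-sym u v (f , ¬ab) = F-sym u v f , ¬ab ∘ SameEdge-sym

        joined : ∀ {u v} → SameEdge u v a b → Star (Minus adj F) u v
        joined (inj₁ (refl , refl)) = a⇝b
        joined (inj₂ (refl , refl)) = reverse (Minus-sym adj-sym F-sym) a⇝b

        edge-joined : ∀ {u v} → Minus adj (Without F a b) u v → ¬ ¬ Star (Minus adj F) u v
        edge-joined (e , ¬w) = ¬¬-map [ (λ ¬f → (e , ¬f) ◅ ε) , joined ]
          λ k → k (inj₁ λ f → ¬w (f , λ ab → k (inj₂ ab)))

module _ {V : Set} {Lab : V → Set} {k : ℕ} (P : Fin k → PhyloTree Lab) where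

  treeVertices : Fin k → List V
  treeVertices i = proj₁ (finite (P i))

  displayVertices : List V
  displayVertices = concatMap treeVertices (allFin k)

  displayVertices-complete : ∀ {v} → DVert P v → v ∈ displayVertices
  displayVertices-complete (i , v-vert) =
    ∈-concatMap⁺ treeVertices (lose (∈-allFin i) (proj₂ (finite (P i)) _ v-vert))

  DAdj-ends : ∀ {u v} → DAdj P u v → DVert P u × DVert P v
  DAdj-ends (i , e) = (i , adj-vert (P i) e) , (i , adj-vert (P i) (adj-sym (P i) e))

  DAdj-sym : ∀ {u v} → DAdj P u v → DAdj P v u
  DAdj-sym (i , e) = i , adj-sym (P i) e

lemma7 : {V : Set} {Lab : V → Set} {k : ℕ} (P : Fin k → PhyloTree Lab) →
    IsProfile P →
    Connected (DVert P) (DAdj P) →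
    (F : V → V → Set) → IsMinimalCut (DVert P) (DAdj P) F →
    (t : Fin k) (a b : V) → adj (P t) a b → F a b →
    (∀ u v → F u v → adj (P t) u v → SameEdge u v a b) →
    (x₁ y₁ x₂ y₂ : V) →
    adj (P t) x₁ y₁ → ¬ SameEdge x₁ y₁ a b →
    Star (λ u v → adj (P t) u v × ¬ SameEdge u v a b) a x₁ →
    Star (λ u v → adj (P t) u v × ¬ SameEdge u v a b) a y₁ →
    adj (P t) x₂ y₂ → ¬ SameEdge x₂ y₂ a b →
    Star (λ u v → adj (P t) u v × ¬ SameEdge u v a b) b x₂ →
    Star (λ u v → adj (P t) u v × ¬ SameEdge u v a b) b y₂ →
    ¬ Star (Minus (DAdj P) F) x₁ x₂
-- Only the endpoints x₁, x₂ of f₁, f₂ matter.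
lemma7 P _ _ F minimalCut@((F-sym , _) , _) t a b _ Fab F∩T⊆e
  x₁ _ x₂ _ _ _ a⇝x₁ _ _ _ b⇝x₂ _ x₁⇝x₂ =
  minimalCut-separates (displayVertices P) (displayVertices-complete P)
    (DAdj-ends P) (DAdj-sym P) minimalCut Fab
    (map T-e⊆G-F a⇝x₁ ◅◅ x₁⇝x₂ ◅◅ reverse (Minus-sym (DAdj-sym P) F-sym) (map T-e⊆G-F b⇝x₂))
  where
  T-e⊆G-F : ∀ {u v} → adj (P t) u v × ¬ SameEdge u v a b → Minus (DAdj P) F u v
  T-e⊆G-F (e , ¬ab) = (t , e) , λ f → ¬ab (F∩T⊆e _ _ f e)
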